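{- Let $\mathcal{H}=\bigcup_{i\in[t]}\bigcup_{j\in[\ell_i]}P_{i,j}$ be a coarse ear-decomposition in a graph $G$. If $\mathcal{H}$ has an edge $v_1v_2$ where both $v_1$ and $v_2$ have degree at least $3$ in $\mathcal{H}$, then there exists a unique pair $(p,q)$ with $p\in[t]$, $q\in[\ell_p]$, $q\ge2$, such that $\{v_1,v_2\}=\{a_{p,q},b_{p,q}\}$.
   Context: Graphs are finite and simple; $[i]=\{1,\dots,i\}$. For $S\subseteq V(G)$ and $r\ge0$, $B_G(S,r)$ is the set of vertices at distance at most $r$ from $S$ in $G$. $V_{\ge3}(G)$ is the set of vertices of degree at least $3$ in $G$. For a subgraph $H$ of $G$, an $H$-path is a path in $G$ of length at least $1$ whose ends lie in $V(H)$, whose internal vertices are not in $V(H)$, and which shares no edge with $H$. Coarse ear-decomposition: for positive integers $t,\ell_1,\dots,\ell_t$, a subgraph $\mathcal{H}=\bigcup_{i\in[t]}\bigcup_{j\in[\ell_i]}P_{i,j}$ of $G$ such that, with $H_{0,0}$ the null graph, $\ell_0=0$, $Y_{0,0}=Z_{0,0}=\emptyset$, and for $i\in[t],j\in[\ell_i]$: $H_{i,j}=\bigl(\bigcup_{p\in[i-1]}\bigcup_{q\in[\ell_p]}P_{p,q}\bigr)\cup\bigcup_{r\in[j]}P_{i,r}$, $Y_{i,j}=B_{H_{i,j}}(V_{\ge3}(H_{i,j}),2)$, $Z_{i,j}=B_{G-(V(H_{i,j})\setminus Y_{i,j})}(Y_{i,j},1)$, the following hold. (A) For each $i\in[t]$,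 $G-Z_{i-1,\ell_{i-1}}$ has no $H_{i-1,\ell_{i-1}}$-path. (B) For each $i\in[t]$: if $G-Z_{i-1,\ell_{i-1}}$ has a cycle meeting $V(H_{i-1,\ell_{i-1}})$ in exactly one vertex, then $P_{i,1}$ is a shortest such cycle (type 1); otherwise $P_{i,1}$ is a shortest cycle of $G-Z_{i-1,\ell_{i-1}}$ (type 2). (C) For each $i\in[t]$ and $j\in[\ell_i]\setminus\{1\}$, $P_{i,j}$ is a shortest $H_{i,j-1}$-path of $G-Z_{i,j-1}$, with ends $a_{i,j},b_{i,j}$. -}

module Defs where

open import Data.Nat using (ℕ; zero; suc; _≤_; _<_)
open import Data.Fin using (Fin; toℕ)
open import Data.List using (List; []; _∷_; length; head; last)
open import Data.List.Membership.Propositional using (_∈_)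
open import Data.List.Relation.Unary.All using (All)
open import Data.List.Relation.Unary.Linked using (Linked)
open import Data.List.Relation.Unary.Unique.Propositional using (Unique)
open import Data.Maybe using (just)
open import Data.Product using (Σ; _×_; _,_; proj₁; proj₂)
open import Data.Sum using (_⊎_)
open import Data.Empty using (⊥)
open import Data.Unit using (⊤)
open import Relation.Binary.PropositionalEquality using (_≡_; _≢_)
open import Relation.Nullary using (¬_)

record Graph (n : ℕ) : Set₁ where
  field
    Adj    : Fin n → Fin n → Set
    sym    : ∀ {x y} → Adj x y → Adj y x
    irrefl : ∀ {x} → ¬ Adj x x
open Graph public

record Subgraph (n : ℕ) : Set₁ where
  field
    V : Fin n → Set
    E : Fin n → Fin n → Set
open Subgraph public

Deg≥3 : {n : ℕ} → Subgraph n → Fin n → Set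
Deg≥3 {n} H v = V H v × Σ (Fin n) λ x → Σ (Fin n) λ y → Σ (Fin n) λ z →
  (x ≢ y × x ≢ z × y ≢ z) × (E H v x × E H v y × E H v z)

Ball : {n : ℕ} → (Fin n → Fin n → Set) → (Fin n → Set) → ℕ → Fin n → Set
Ball E S zero    x = S x
Ball {n} E S (suc r) x = Ball E S r x ⊎ Σ (Fin n) λ y → Ball E S r y × E y x

DelE : {n : ℕ} → Graph n → (Fin n → Set) → Fin n → Fin n → Set
DelE G X x y = ¬ X x × ¬ X y × Adj G x y

Yset : {n : ℕ} → Subgraph n → Fin n → Set
Yset H = Ball (E H) (Deg≥3 H) 2

Xset : {n : ℕ} → Subgraph n → Fin n → Set
Xset H x = V H x × ¬ Yset H x

Zset : {n : ℕ} → Graph n → Subgraph n → Fin n → Set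
Zset G H = Ball (DelE G (Xset H)) (Yset H) 1

ConsecEdge : {A : Set} → List A → A → A → Set
ConsecEdge []           a b = ⊥
ConsecEdge (x ∷ [])     a b = ⊥
ConsecEdge (x ∷ y ∷ xs) a b =
  ((a ≡ x × b ≡ y) ⊎ (a ≡ y × b ≡ x)) ⊎ ConsecEdge (y ∷ xs) a b

CycleEdge : {A : Set} → List A → A → A → Set
CycleEdge L a b = ConsecEdge L a b ⊎
  ((head L ≡ just a × last L ≡ just b) ⊎ (head L ≡ just b × last L ≡ just a))

EndSet : {A : Set} → List A → A → Set
EndSet L x = head L ≡ just x ⊎ last L ≡ just x

dropLast : {A : Set} → List A → List A
dropLast []           = []
dropLast (x ∷ [])     = []
dropLast (x ∷ y ∷ xs) = x ∷ dropLast (y ∷ xs)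

inner : {A : Set} → List A → List A
inner []       = []
inner (x ∷ xs) = dropLast xs

Avoids : {n : ℕ} → (Fin n → Set) → List (Fin n) → Set
Avoids X L = All (λ x → ¬ X x) L

IsPath : {n : ℕ} → Graph n → List (Fin n) → Set
IsPath G L = Unique L × Linked (Adj G) L

IsCycle : {n : ℕ} → Graph n → List (Fin n) → Set
IsCycle {n} G L = Unique L × Linked (Adj G) L × 3 ≤ length L ×
  Σ (Fin n) λ a → Σ (Fin n) λ b → head L ≡ just a × last L ≡ just b × Adj G b a

CycleIn : {n : ℕ} → Graph n → (Fin n → Set) → List (Fin n) → Set
CycleIn G Z L = IsCycle G L × Avoids Z L

HPathIn : {n : ℕ} → Graph n → Subgraph n → (Fin n → Set) → List (Fin n) → Set
HPathIn G H Z L = IsPath G L × Avoids Z L × 2 ≤ length L ×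
  (∀ x → EndSet L x → V H x) × All (λ x → ¬ V H x) (inner L) ×
  (∀ a b → ConsecEdge L a b → ¬ E H a b)

MeetsOnce : {n : ℕ} → Subgraph n → List (Fin n) → Set
MeetsOnce {n} H L = Σ (Fin n) λ x → x ∈ L × V H x × (∀ y → y ∈ L → V H y → y ≡ x)

-- Coarse ear-decompositions
-- Indices are 0-based: P i j with i : Fin t, j : Fin (ℓ i) is P_{i+1,j+1}.
-- P i j with toℕ j ≡ 0 is read as a cycle, otherwise as a path.

record EarData (n : ℕ) : Set where
  field
    t     : ℕ
    ℓ     : Fin t → ℕ
    P     : (i : Fin t) → Fin (ℓ i) → List (Fin n)
open EarData public

Idx : {n : ℕ} → EarData n → Set
Idx D = Σ (Fin (t D)) λ i → Fin (ℓ D i)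

earE : {A : Set} → List A → ℕ → A → A → Set
earE L zero    = CycleEdge L
earE L (suc _) = ConsecEdge L

earP : {n : ℕ} → (D : EarData n) → Idx D → List (Fin n)
earP D e = P D (proj₁ e) (proj₂ e)

SubOf : {n : ℕ} → (D : EarData n) → (Idx D → Set) → Subgraph n
SubOf D Sel = record
  { V = λ x → Σ (Idx D) λ e → Sel e × x ∈ earP D e
  ; E = λ a b → Σ (Idx D) λ e → Sel e × earE (earP D e) (toℕ (proj₂ e)) a b }

-- H_{i-1,ℓ_{i-1}} (for the 0-based block i): all ears of earlier blocks
Hlt : {n : ℕ} → (D : EarData n) → Fin (t D) → Subgraph n
Hlt D i = SubOf D (λ e → toℕ (proj₁ e) < toℕ i)

-- H_{i,k+1} (1-based): earlier blocks, plus ears of block i with 0-based index ≤ k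
Hle : {n : ℕ} → (D : EarData n) → Fin (t D) → ℕ → Subgraph n
Hle D i k = SubOf D (λ e → toℕ (proj₁ e) < toℕ i ⊎ (proj₁ e ≡ i × toℕ (proj₂ e) ≤ k))

Hall : {n : ℕ} → EarData n → Subgraph n
Hall D = SubOf D (λ _ → ⊤)

record IsCoarseEarDecomposition {n : ℕ} (G : Graph n) (D : EarData n) : Set where
  field
    t-pos : 1 ≤ t D
    ℓ-pos : ∀ i → 1 ≤ ℓ D i
    condA : ∀ i L → ¬ HPathIn G (Hlt D i) (Zset G (Hlt D i)) L
    condB : ∀ i (j : Fin (ℓ D i)) → toℕ j ≡ 0 →
      ((Σ (List (Fin n)) λ L → CycleIn G (Zset G (Hlt D i)) L × MeetsOnce (Hlt D i) L) →
         CycleIn G (Zset G (Hlt D i)) (P D i j) × MeetsOnce (Hlt D i) (P D i j) ×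
         (∀ L → CycleIn G (Zset G (Hlt D i)) L → MeetsOnce (Hlt D i) L →
            length (P D i j) ≤ length L))
      ×
      (¬ (Σ (List (Fin n)) λ L → CycleIn G (Zset G (Hlt D i)) L × MeetsOnce (Hlt D i) L) →
         CycleIn G (Zset G (Hlt D i)) (P D i j) ×
         (∀ L → CycleIn G (Zset G (Hlt D i)) L → length (P D i j) ≤ length L))
    condC : ∀ i (j : Fin (ℓ D i)) k → toℕ j ≡ suc k →
      HPathIn G (Hle D i k) (Zset G (Hle D i k)) (P D i j) ×
      (∀ L → HPathIn G (Hle D i k) (Zset G (Hle D i k)) L → length (P D i j) ≤ length L)

-- Order the ears as they are added and let Q be the first ear after which v₁ or v₂ has degree
-- at least 3.  An ear avoids B(V≥3, 2) of the graph built before it, so every ear through a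
-- vertex at distance at most 1 from V≥3(H≼Q) comes no later than Q.  Applied to v₁ and then to
-- its neighbour v₂, this puts every ℋ-edge at v₁ and v₂ into H≼Q: both vertices reach degree 3
-- exactly at Q, lie on P_Q, and already lie in the graph H built before Q (a vertex new at Q has
-- only its two P_Q-edges).  If P_Q were a cycle, walking along it from v₁ through an edge outside
-- H up to the next vertex of H (at worst v₂) would give an H-path avoiding Z, against (A).  So
-- P_Q is a path whose inner vertices are new, hence its ends are v₁ and v₂.  Every vertex of an
-- H_{i,j} has two neighbours in it (look at the first ear through it), so the ends of a path ear
-- reach degree 3 at that ear; an earlier path ear with ends v₁, v₂ would contradict the choice
-- of Q.  The argument is classical: it runs in the double-negation monad, and the conclusion is
-- recovered because it is decidable.

module Submission where

open import Defs
open import Level using (0ℓ)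
open import Data.Nat using (ℕ; zero; suc; _≤_; _<_; s≤s; z≤n)
open import Data.Nat.Induction using (<-wellFounded)
import Data.Nat.Properties as ℕ
open import Data.Fin using (Fin; toℕ)
open import Data.Fin.Properties using (toℕ-injective; any?; all?) renaming (_≟_ to _≟ᶠ_)
open import Data.Empty using (⊥-elim)
open import Data.Sum using (_⊎_; inj₁; inj₂)
import Data.Sum as Sum
open import Data.Product using (_×_; ∃; ∃!; _,_; proj₁; proj₂)
import Data.Product as Product
import Data.Product.Properties as Product
open import Data.Product.Relation.Binary.Lex.Strict using (×-Lex; ×-wellFounded; ×-isStrictTotalOrder)
open import Data.Product.Relation.Binary.Pointwise.NonDependent using (Pointwise)
open import Data.Maybe using (Maybe; just)
open import Data.Maybe.Properties using (just-injective)
import Data.Maybe.Properties as Maybe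
open import Data.List using (List; []; _∷_; _++_; [_]; length; head; last; reverse)
open import Data.List.Properties
  using (length-++; ++-assoc; ++-identityʳ; unfold-reverse; reverse-involutive)
open import Data.List.Membership.Propositional using (_∈_; _∉_; lose)
open import Data.List.Membership.Propositional.Properties using (∈-∃++)
open import Data.List.Relation.Unary.Any using (Any; here; there)
open import Data.List.Relation.Unary.All as All using (All; []; _∷_)
import Data.List.Relation.Unary.All.Properties as All
open import Data.List.Relation.Unary.AllPairs using (AllPairs; []; _∷_)
open import Data.List.Relation.Unary.Linked using (Linked; []; [-]; _∷_)
open import Data.List.Relation.Unary.Unique.Propositional using (Unique)
open import Data.List.Relation.Unary.First as First using (First)
open import Data.List.Relation.Unary.First.Properties using (toView)
open import Data.List.Relation.Binary.Permutation.Propositional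
  using (_↭_; ↭⇒↭ₛ; ↭-sym; ↭-trans; ↭-refl)
open import Data.List.Relation.Binary.Permutation.Propositional.Properties
  using (++-comm; ↭-reverse; ∈-resp-↭; All-resp-↭; ↭-length)
import Data.List.Relation.Binary.Permutation.Setoid.Properties as SetoidPerm
open import Effect.Monad using (RawMonad)
open import Function using (_∘_; id; _on_; case_of_)
open import Function.Bundles using (_⇔_; mk⇔; Equivalence)
open import Induction.WellFounded using (WellFounded; Acc; acc)
open import Relation.Nullary using (¬_; Dec; yes; no)
open import Relation.Nullary.Decidable
  using (¬¬-excluded-middle; decidable-stable; map′; _×-dec_; _⊎-dec_; _→-dec_)
open import Relation.Nullary.Negation using (¬¬-Monad)
open import Relation.Unary using (∁)
open import Relation.Binary using (Rel; Symmetric; DecidableEquality; IsStrictTotalOrder)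
open import Relation.Binary.Definitions using (tri<; tri≈; tri>)
import Relation.Binary.Construct.On as On
open import Relation.Binary.PropositionalEquality
  using (_≡_; _≢_; refl; cong; subst; subst₂; setoid) renaming (sym to ≡-sym; trans to ≡-trans)

open RawMonad (¬¬-Monad {0ℓ})

¬¬-minimal : {A : Set} {_<_ : Rel A 0ℓ} {P : A → Set} → WellFounded _<_ →
  ∀ {x} → P x → ¬ ¬ ∃ λ m → P m × (∀ {y} → y < m → ¬ P y)
¬¬-minimal {_<_ = _<_} {P} wf {x} = go (wf x)
  where
  go : ∀ {x} → Acc _<_ x → P x → ¬ ¬ ∃ λ m → P m × (∀ {y} → y < m → ¬ P y)
  go {x} (acc rs) px = do
    yes (y , y<x , py) ← ¬¬-excluded-middle {A = ∃ λ y → y < x × P y}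
      where no none → pure (x , px , λ {y} y<x py → none (y , y<x , py))
    go (rs y<x) py

¬¬-first : {A : Set} {P : A → Set} {xs : List A} → Any P xs → ¬ ¬ First (∁ P) P xs
¬¬-first (here px) = pure First.[ px ]
¬¬-first {P = P} (there {x = x} any) = do
  no ¬px ← ¬¬-excluded-middle {A = P x}
    where yes px → pure First.[ px ]
  (¬px First.∷_) <$> ¬¬-first any

_⇔-dec_ : {A B : Set} → Dec A → Dec B → Dec (A ⇔ B)
a? ⇔-dec b? = map′ (λ (to , from) → mk⇔ to from) (λ a⇔b → Equivalence.to a⇔b , Equivalence.from a⇔b)
                   ((a? →-dec b?) ×-dec (b? →-dec a?))

∃!-stable : {A : Set} {P : A → Set} → Dec (∃ P) → DecidableEquality A →
  ¬ ¬ ∃! _≡_ P → ∃! _≡_ P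
∃!-stable ∃P? _≟_ ¬¬∃! with decidable-stable ∃P? ((λ (x , px , _) → x , px) <$> ¬¬∃!)
... | x , px = x , px , λ {y} py → decidable-stable (x ≟ y) do
  (z , _ , unique) ← ¬¬∃!
  pure (≡-trans (≡-sym (unique px)) (unique py))

-- CycleEdge L a b unfolds to ConsecEdge L a b ⊎ Joins (head L) (last L) a b.
Joins : {A : Set} → Maybe A → Maybe A → A → A → Set
Joins p q a b = (p ≡ just a × q ≡ just b) ⊎ (p ≡ just b × q ≡ just a)

record TwoNeighbours {A : Set} (R : A → A → Set) (v : A) : Set where
  constructor two-neighbours
  field
    {left right} : A
    distinct : left ≢ right
    to-left : R v left
    to-right : R v right

TwoNeighbours-map : {A : Set} {R R′ : A → A → Set} {v : A} →
  (∀ {w} → R v w → R′ v w) → TwoNeighbours R v → TwoNeighbours R′ v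
TwoNeighbours-map f (two-neighbours a≢b va vb) = two-neighbours a≢b (f va) (f vb)

module _ {A : Set} where

  ≡just-unique : ∀ {m : Maybe A} {x y} → m ≡ just x → m ≡ just y → x ≡ y
  ≡just-unique refl refl = refl

  Joins-comm : ∀ {p q : Maybe A} {a b} → Joins p q a b → Joins q p a b
  Joins-comm (inj₁ (p≡a , q≡b)) = inj₂ (q≡b , p≡a)
  Joins-comm (inj₂ (p≡b , q≡a)) = inj₁ (q≡a , p≡b)

  Joins-just⁺ : ∀ {x y a b : A} → (a ≡ x × b ≡ y) ⊎ (a ≡ y × b ≡ x) →
    Joins (just x) (just y) a b
  Joins-just⁺ (inj₁ (refl , refl)) = inj₁ (refl , refl)
  Joins-just⁺ (inj₂ (refl , refl)) = inj₂ (refl , refl)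

  Joins-just⁻ : ∀ {x y a b : A} → Joins (just x) (just y) a b →
    (a ≡ x × b ≡ y) ⊎ (a ≡ y × b ≡ x)
  Joins-just⁻ (inj₁ (refl , refl)) = inj₁ (refl , refl)
  Joins-just⁻ (inj₂ (refl , refl)) = inj₂ (refl , refl)

  head-∈ : ∀ {L : List A} {x} → head L ≡ just x → x ∈ L
  head-∈ {_ ∷ _} refl = here refl

  last-∈ : ∀ {L : List A} {x} → last L ≡ just x → x ∈ L
  last-∈ {_ ∷ []} refl = here refl
  last-∈ {_ ∷ _ ∷ _} l = there (last-∈ l)

  end-∈ : ∀ {L : List A} {x} → EndSet L x → x ∈ L
  end-∈ (inj₁ h) = head-∈ h
  end-∈ (inj₂ l) = last-∈ l

  head-++ : ∀ (xs : List A) {y ys ys′} → head (xs ++ y ∷ ys) ≡ head (xs ++ y ∷ ys′)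
  head-++ [] = refl
  head-++ (_ ∷ _) = refl

  last-++ : ∀ (xs : List A) {y ys} → last (xs ++ y ∷ ys) ≡ last (y ∷ ys)
  last-++ [] = refl
  last-++ (_ ∷ []) = refl
  last-++ (_ ∷ x ∷ xs) = last-++ (x ∷ xs)

  last-reverse : ∀ (xs : List A) → last (reverse xs) ≡ head xs
  last-reverse [] = refl
  last-reverse (x ∷ xs) = ≡-trans (cong last (unfold-reverse x xs)) (last-++ (reverse xs))

  head-reverse : ∀ (xs : List A) → head (reverse xs) ≡ last xs
  head-reverse xs = ≡-trans (≡-sym (last-reverse (reverse xs))) (cong last (reverse-involutive xs))

  last-nonempty : ∀ (x : A) xs → ∃ λ ℓ → last (x ∷ xs) ≡ just ℓ
  last-nonempty x [] = x , refl
  last-nonempty _ (x ∷ xs) = last-nonempty x xs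

  last-tail : ∀ {v w : A} rest → v ≢ w → last (v ∷ rest) ≡ just w → last rest ≡ just w
  last-tail [] v≢w l = ⊥-elim (v≢w (just-injective l))
  last-tail (_ ∷ _) _ l = l

  head≡just : ∀ {xs : List A} {x} → head xs ≡ just x → ∃ λ ys → xs ≡ x ∷ ys
  head≡just {_ ∷ ys} refl = ys , refl

  dropLast-∷ʳ : ∀ (xs : List A) {x} → dropLast (xs ++ [ x ]) ≡ xs
  dropLast-∷ʳ [] = refl
  dropLast-∷ʳ (_ ∷ []) = refl
  dropLast-∷ʳ (y ∷ z ∷ xs) = cong (y ∷_) (dropLast-∷ʳ (z ∷ xs))

  AllPairs-++⁻ˡ : ∀ {R : Rel A 0ℓ} (xs : List A) {ys} → AllPairs R (xs ++ ys) → AllPairs R xs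
  AllPairs-++⁻ˡ [] _ = []
  AllPairs-++⁻ˡ (_ ∷ xs) (px ∷ pxs) = All.++⁻ˡ xs px ∷ AllPairs-++⁻ˡ xs pxs

  consecEdge-∈ : ∀ (L : List A) {a b} → ConsecEdge L a b → a ∈ L
  consecEdge-∈ (_ ∷ _ ∷ _) (inj₁ (inj₁ (refl , _))) = here refl
  consecEdge-∈ (_ ∷ _ ∷ _) (inj₁ (inj₂ (refl , _))) = there (here refl)
  consecEdge-∈ (_ ∷ y ∷ xs) (inj₂ c) = there (consecEdge-∈ (y ∷ xs) c)

  cycleEdge-∈ : ∀ (L : List A) {a b} → CycleEdge L a b → a ∈ L
  cycleEdge-∈ L (inj₁ c) = consecEdge-∈ L c
  cycleEdge-∈ L (inj₂ (inj₁ (h , _))) = head-∈ h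
  cycleEdge-∈ L (inj₂ (inj₂ (_ , l))) = last-∈ l

  consecEdge-sym : ∀ (L : List A) {a b} → ConsecEdge L a b → ConsecEdge L b a
  consecEdge-sym (_ ∷ _ ∷ _) (inj₁ (inj₁ (a≡x , b≡y))) = inj₁ (inj₂ (b≡y , a≡x))
  consecEdge-sym (_ ∷ _ ∷ _) (inj₁ (inj₂ (a≡y , b≡x))) = inj₁ (inj₁ (b≡x , a≡y))
  consecEdge-sym (_ ∷ y ∷ xs) (inj₂ c) = inj₂ (consecEdge-sym (y ∷ xs) c)

  cycleEdge-sym : ∀ (L : List A) {a b} → CycleEdge L a b → CycleEdge L b a
  cycleEdge-sym L (inj₁ c) = inj₁ (consecEdge-sym L c)
  cycleEdge-sym L (inj₂ j) = inj₂ (Sum.swap j)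

  consecEdge-∷ : ∀ {x : A} {xs a b} → ConsecEdge (x ∷ xs) a b →
    Joins (just x) (head xs) a b ⊎ ConsecEdge xs a b
  consecEdge-∷ {xs = _ ∷ _} (inj₁ s) = inj₁ (Joins-just⁺ s)
  consecEdge-∷ {xs = _ ∷ _} (inj₂ c) = inj₂ c

  consecEdge-++⁻ : ∀ (xs : List A) {ys a b} → ConsecEdge (xs ++ ys) a b →
    ConsecEdge xs a b ⊎ ConsecEdge ys a b ⊎ Joins (last xs) (head ys) a b
  consecEdge-++⁻ [] c = inj₂ (inj₁ c)
  consecEdge-++⁻ (_ ∷ []) {_ ∷ _} (inj₁ s) = inj₂ (inj₂ (Joins-just⁺ s))
  consecEdge-++⁻ (_ ∷ []) {_ ∷ _} (inj₂ c) = inj₂ (inj₁ c)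
  consecEdge-++⁻ (_ ∷ _ ∷ _) (inj₁ s) = inj₁ (inj₁ s)
  consecEdge-++⁻ (_ ∷ x ∷ xs) (inj₂ c) = Sum.map₁ inj₂ (consecEdge-++⁻ (x ∷ xs) c)

  consecEdge-++⁺ : ∀ (xs : List A) {ys a b} →
    ConsecEdge xs a b ⊎ ConsecEdge ys a b ⊎ Joins (last xs) (head ys) a b → ConsecEdge (xs ++ ys) a b
  consecEdge-++⁺ [] (inj₂ (inj₁ c)) = c
  consecEdge-++⁺ [] (inj₂ (inj₂ (inj₁ (() , _))))
  consecEdge-++⁺ [] (inj₂ (inj₂ (inj₂ (() , _))))
  consecEdge-++⁺ (_ ∷ []) {[]} (inj₂ (inj₂ (inj₁ (_ , ()))))
  consecEdge-++⁺ (_ ∷ []) {[]} (inj₂ (inj₂ (inj₂ (_ , ()))))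
  consecEdge-++⁺ (_ ∷ []) {_ ∷ _} (inj₂ (inj₁ c)) = inj₂ c
  consecEdge-++⁺ (_ ∷ []) {_ ∷ _} (inj₂ (inj₂ j)) = inj₁ (Joins-just⁻ j)
  consecEdge-++⁺ (_ ∷ _ ∷ _) (inj₁ (inj₁ s)) = inj₁ s
  consecEdge-++⁺ (_ ∷ x ∷ xs) (inj₁ (inj₂ c)) = inj₂ (consecEdge-++⁺ (x ∷ xs) (inj₁ c))
  consecEdge-++⁺ (_ ∷ x ∷ xs) (inj₂ r) = inj₂ (consecEdge-++⁺ (x ∷ xs) (inj₂ r))

  consecEdge-∷ʳ : ∀ (xs : List A) {x a b} → ConsecEdge (xs ++ [ x ]) a b → a ∈ xs ⊎ b ∈ xs
  consecEdge-∷ʳ (_ ∷ []) (inj₁ (inj₁ (refl , _))) = inj₁ (here refl)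
  consecEdge-∷ʳ (_ ∷ []) (inj₁ (inj₂ (_ , refl))) = inj₂ (here refl)
  consecEdge-∷ʳ (_ ∷ _ ∷ _) (inj₁ (inj₁ (refl , _))) = inj₁ (here refl)
  consecEdge-∷ʳ (_ ∷ _ ∷ _) (inj₁ (inj₂ (_ , refl))) = inj₂ (here refl)
  consecEdge-∷ʳ (_ ∷ y ∷ xs) (inj₂ c) = Sum.map there there (consecEdge-∷ʳ (y ∷ xs) c)

  consecEdge-reverse : ∀ (xs : List A) {a b} → ConsecEdge xs a b → ConsecEdge (reverse xs) a b
  consecEdge-reverse (x ∷ y ∷ xs) {a} {b} c =
    subst (λ L → ConsecEdge L a b) (≡-sym (unfold-reverse x (y ∷ xs)))
      (consecEdge-++⁺ (reverse (y ∷ xs)) (split c))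
    where
    split : ConsecEdge (x ∷ y ∷ xs) a b → ConsecEdge (reverse (y ∷ xs)) a b ⊎ ConsecEdge [ x ] a b ⊎
                                           Joins (last (reverse (y ∷ xs))) (just x) a b
    split (inj₁ s) = inj₂ (inj₂ (subst (λ m → Joins m (just x) a b) (≡-sym (last-reverse (y ∷ xs)))
                                   (Joins-comm (Joins-just⁺ s))))
    split (inj₂ c) = inj₁ (consecEdge-reverse (y ∷ xs) c)

  cycleEdge-++-comm : ∀ (xs ys : List A) {a b} → CycleEdge (xs ++ ys) a b → CycleEdge (ys ++ xs) a b
  cycleEdge-++-comm [] ys {a} {b} = subst (λ L → CycleEdge L a b) (≡-sym (++-identityʳ ys))
  cycleEdge-++-comm xs [] {a} {b} = subst (λ L → CycleEdge L a b) (++-identityʳ xs)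
  cycleEdge-++-comm (x ∷ xs) (y ∷ ys) {a} {b} (inj₁ c) with consecEdge-++⁻ (x ∷ xs) c
  ... | inj₁ cx = inj₁ (consecEdge-++⁺ (y ∷ ys) (inj₂ (inj₁ cx)))
  ... | inj₂ (inj₁ cy) = inj₁ (consecEdge-++⁺ (y ∷ ys) (inj₁ cy))
  ... | inj₂ (inj₂ j) =
    inj₂ (subst (λ m → Joins (just y) m a b) (≡-sym (last-++ (y ∷ ys))) (Joins-comm j))
  cycleEdge-++-comm (x ∷ xs) (y ∷ ys) {a} {b} (inj₂ j) =
    inj₁ (consecEdge-++⁺ (y ∷ ys) (inj₂ (inj₂ junction)))
    where junction = Joins-comm (subst (λ m → Joins (just x) m a b) (last-++ (x ∷ xs)) j)

  cycleEdge-reverse⁺ : ∀ (xs : List A) {a b} → CycleEdge xs a b → CycleEdge (reverse xs) a b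
  cycleEdge-reverse⁺ xs (inj₁ c) = inj₁ (consecEdge-reverse xs c)
  cycleEdge-reverse⁺ xs {a} {b} (inj₂ j) =
    inj₂ (subst₂ (λ p q → Joins p q a b) (≡-sym (head-reverse xs)) (≡-sym (last-reverse xs))
                 (Joins-comm j))

  cycleEdge-reverse⁻ : ∀ (xs : List A) {a b} → CycleEdge (reverse xs) a b → CycleEdge xs a b
  cycleEdge-reverse⁻ xs {a} {b} c =
    subst (λ L → CycleEdge L a b) (reverse-involutive xs) (cycleEdge-reverse⁺ (reverse xs) c)

  record SameCycle (L L′ : List A) : Set where
    field
      perm   : L ↭ L′
      edges⁺ : ∀ {a b} → CycleEdge L a b → CycleEdge L′ a b
      edges⁻ : ∀ {a b} → CycleEdge L′ a b → CycleEdge L a b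
  open SameCycle public

  SameCycle-reflexive : ∀ {L L′ : List A} → L ≡ L′ → SameCycle L L′
  SameCycle-reflexive refl = record { perm = ↭-refl ; edges⁺ = id ; edges⁻ = id }

  SameCycle-trans : ∀ {L L′ L″ : List A} →
    SameCycle L L′ → SameCycle L′ L″ → SameCycle L L″
  SameCycle-trans s t = record
    { perm = ↭-trans (perm s) (perm t)
    ; edges⁺ = edges⁺ t ∘ edges⁺ s
    ; edges⁻ = edges⁻ s ∘ edges⁻ t
    }

  SameCycle-rotate : ∀ (xs ys : List A) → SameCycle (xs ++ ys) (ys ++ xs)
  SameCycle-rotate xs ys = record
    { perm = ++-comm xs ys
    ; edges⁺ = cycleEdge-++-comm xs ys
    ; edges⁻ = cycleEdge-++-comm ys xs
    }

  SameCycle-reverse : ∀ (xs : List A) → SameCycle xs (reverse xs)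
  SameCycle-reverse xs = record
    { perm = ↭-sym (↭-reverse xs)
    ; edges⁺ = cycleEdge-reverse⁺ xs
    ; edges⁻ = cycleEdge-reverse⁻ xs
    }

  SameCycle-reverse-tail : ∀ (v : A) rest → SameCycle (v ∷ rest) (v ∷ reverse rest)
  SameCycle-reverse-tail v rest = SameCycle-trans (SameCycle-reverse (v ∷ rest))
    (SameCycle-trans (SameCycle-reflexive (unfold-reverse v rest)) (SameCycle-rotate (reverse rest) [ v ]))

  SameCycle-unique : ∀ {L L′ : List A} → SameCycle L L′ → Unique L → Unique L′
  SameCycle-unique s = Unique-resp-↭ (↭⇒↭ₛ (perm s))
    where open SetoidPerm (setoid A) using (Unique-resp-↭)

  rotate-to-vertex : ∀ {L : List A} {v} → v ∈ L → ∃ λ rest → SameCycle L (v ∷ rest)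
  rotate-to-vertex v∈L with ∈-∃++ v∈L
  ... | pre , suf , refl = suf ++ pre , SameCycle-rotate pre (_ ∷ suf)

  cycleEdge-head : ∀ {v w : A} {rest} → Unique (v ∷ rest) → CycleEdge (v ∷ rest) v w →
    head rest ≡ just w ⊎ last (v ∷ rest) ≡ just w
  cycleEdge-head {rest = _ ∷ _} _ (inj₁ (inj₁ (inj₁ (_ , refl)))) = inj₁ refl
  cycleEdge-head {rest = _ ∷ _} ((v≢r ∷ _) ∷ _) (inj₁ (inj₁ (inj₂ (v≡r , _)))) =
    ⊥-elim (v≢r v≡r)
  cycleEdge-head {rest = r ∷ rs} (v∉ ∷ _) (inj₁ (inj₂ c)) =
    ⊥-elim (All.lookup v∉ (consecEdge-∈ (r ∷ rs) c) refl)
  cycleEdge-head _ (inj₂ (inj₁ (_ , l))) = inj₂ l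
  cycleEdge-head _ (inj₂ (inj₂ (refl , l))) = inj₂ l

  rotate-to-edge : ∀ {L : List A} {v w} → Unique L → v ≢ w → CycleEdge L v w →
    ∃ λ ws → SameCycle L (v ∷ w ∷ ws)
  rotate-to-edge {L} {v} uL v≢w vw with rotate-to-vertex (cycleEdge-∈ L vw)
  ... | rest , same with cycleEdge-head (SameCycle-unique same uL) (edges⁺ same vw)
  ...   | inj₁ w-first with head≡just w-first
  ...     | ws , refl = ws , same
  rotate-to-edge {L} {v} uL v≢w vw | rest , same | inj₂ w-last
    with head≡just (≡-trans (head-reverse rest) (last-tail rest v≢w w-last))
  ... | ws , reversed = ws , SameCycle-trans same
        (SameCycle-trans (SameCycle-reverse-tail v rest) (SameCycle-reflexive (cong (v ∷_) reversed)))

  at-most-two : ∀ {p q : Maybe A} {x y z} →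
    p ≡ just x ⊎ q ≡ just x → p ≡ just y ⊎ q ≡ just y → p ≡ just z ⊎ q ≡ just z →
    x ≡ y ⊎ x ≡ z ⊎ y ≡ z
  at-most-two (inj₁ a) (inj₁ b) _ = inj₁ (≡just-unique a b)
  at-most-two (inj₂ a) (inj₂ b) _ = inj₁ (≡just-unique a b)
  at-most-two (inj₁ a) (inj₂ _) (inj₁ c) = inj₂ (inj₁ (≡just-unique a c))
  at-most-two (inj₁ _) (inj₂ b) (inj₂ c) = inj₂ (inj₂ (≡just-unique b c))
  at-most-two (inj₂ _) (inj₁ b) (inj₁ c) = inj₂ (inj₂ (≡just-unique b c))
  at-most-two (inj₂ a) (inj₁ _) (inj₂ c) = inj₂ (inj₁ (≡just-unique a c))

  head-≤2-neighbours : ∀ {v : A} {rest x y z} → Unique (v ∷ rest) →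
    CycleEdge (v ∷ rest) v x → CycleEdge (v ∷ rest) v y → CycleEdge (v ∷ rest) v z →
    ¬ (x ≢ y × x ≢ z × y ≢ z)
  head-≤2-neighbours u vx vy vz (x≢y , x≢z , y≢z)
    with at-most-two (cycleEdge-head u vx) (cycleEdge-head u vy) (cycleEdge-head u vz)
  ... | inj₁ x≡y = x≢y x≡y
  ... | inj₂ (inj₁ x≡z) = x≢z x≡z
  ... | inj₂ (inj₂ y≡z) = y≢z y≡z

  cycle-≤2-neighbours : ∀ {L : List A} {v x y z} → Unique L →
    CycleEdge L v x → CycleEdge L v y → CycleEdge L v z → ¬ (x ≢ y × x ≢ z × y ≢ z)
  cycle-≤2-neighbours {L} uL vx vy vz with rotate-to-vertex (cycleEdge-∈ L vx)
  ... | rest , same =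
    head-≤2-neighbours (SameCycle-unique same uL) (edges⁺ same vx) (edges⁺ same vy) (edges⁺ same vz)

  head-two-neighbours : ∀ {v : A} {rest} → Unique (v ∷ rest) → 3 ≤ length (v ∷ rest) →
    TwoNeighbours (CycleEdge (v ∷ rest)) v
  head-two-neighbours {rest = []} _ (s≤s ())
  head-two-neighbours {rest = _ ∷ []} _ (s≤s (s≤s ()))
  head-two-neighbours {rest = r ∷ r′ ∷ rs} (_ ∷ (r∉ ∷ _)) _ with last-nonempty r′ rs
  ... | ℓ , last≡ℓ =
    two-neighbours (All.lookup r∉ (last-∈ last≡ℓ))
                   (inj₁ (inj₁ (inj₁ (refl , refl)))) (inj₂ (inj₁ (refl , last≡ℓ)))

  cycle-two-neighbours : ∀ {L : List A} {v} → Unique L → 3 ≤ length L → v ∈ L →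
    TwoNeighbours (CycleEdge L) v
  cycle-two-neighbours uL long v∈L with rotate-to-vertex v∈L
  ... | rest , same = TwoNeighbours-map (edges⁻ same)
    (head-two-neighbours (SameCycle-unique same uL) (subst (3 ≤_) (↭-length (perm same)) long))

  inner-two-neighbours : ∀ {L : List A} {v} → Unique L → v ∈ inner L →
    TwoNeighbours (ConsecEdge L) v
  inner-two-neighbours {_ ∷ _ ∷ _ ∷ _} ((_ ∷ x≢z ∷ _) ∷ _) (here refl) =
    two-neighbours x≢z (inj₁ (inj₂ (refl , refl))) (inj₂ (inj₁ (inj₁ (refl , refl))))
  inner-two-neighbours {_ ∷ _ ∷ _ ∷ _} (_ ∷ u) (there v∈) =
    TwoNeighbours-map inj₂ (inner-two-neighbours u v∈)

  end-neighbour : ∀ {L : List A} {v} → 2 ≤ length L → EndSet L v → ∃ λ c → ConsecEdge L v c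
  end-neighbour {_ ∷ []} (s≤s ()) _
  end-neighbour {_ ∷ y ∷ _} _ (inj₁ refl) = y , inj₁ (inj₁ (refl , refl))
  end-neighbour {x ∷ _ ∷ []} _ (inj₂ refl) = x , inj₁ (inj₂ (refl , refl))
  end-neighbour {_ ∷ _ ∷ _ ∷ _} _ (inj₂ l) =
    Product.map₂ inj₂ (end-neighbour (s≤s (s≤s z≤n)) (inj₂ l))

  ∈-dropLast : ∀ {xs : List A} {v} → v ∈ xs → last xs ≡ just v ⊎ v ∈ dropLast xs
  ∈-dropLast {_ ∷ []} (here refl) = inj₁ refl
  ∈-dropLast {_ ∷ _ ∷ _} (here refl) = inj₂ (here refl)
  ∈-dropLast {_ ∷ _ ∷ _} (there v∈) = Sum.map₂ there (∈-dropLast v∈)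

  ∈⇒end⊎inner : ∀ {L : List A} {v} → v ∈ L → EndSet L v ⊎ v ∈ inner L
  ∈⇒end⊎inner (here refl) = inj₁ (inj₁ refl)
  ∈⇒end⊎inner {_ ∷ _ ∷ _} (there v∈) = Sum.map₁ inj₂ (∈-dropLast v∈)

  ends-determined : ∀ {L : List A} {a b x} → EndSet L a → EndSet L b → a ≢ b →
    EndSet L x → x ≡ a ⊎ x ≡ b
  ends-determined (inj₁ ha) (inj₁ hb) a≢b _ = ⊥-elim (a≢b (≡just-unique ha hb))
  ends-determined (inj₂ la) (inj₂ lb) a≢b _ = ⊥-elim (a≢b (≡just-unique la lb))
  ends-determined (inj₁ ha) (inj₂ _) _ (inj₁ hx) = inj₁ (≡just-unique hx ha)
  ends-determined (inj₁ _) (inj₂ lb) _ (inj₂ lx) = inj₂ (≡just-unique lx lb)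
  ends-determined (inj₂ _) (inj₁ hb) _ (inj₁ hx) = inj₂ (≡just-unique hx hb)
  ends-determined (inj₂ la) (inj₁ _) _ (inj₂ lx) = inj₁ (≡just-unique lx la)

  linked⇒consecEdge : ∀ {R : Rel A 0ℓ} {L a b} → Symmetric R → Linked R L →
    ConsecEdge L a b → R a b
  linked⇒consecEdge _ (r ∷ _) (inj₁ (inj₁ (refl , refl))) = r
  linked⇒consecEdge sym (r ∷ _) (inj₁ (inj₂ (refl , refl))) = sym r
  linked⇒consecEdge sym (_ ∷ l) (inj₂ c) = linked⇒consecEdge sym l c

  consecEdge⇒linked : ∀ {R : Rel A 0ℓ} {L} → (∀ {a b} → ConsecEdge L a b → R a b) → Linked R L
  consecEdge⇒linked {L = []} _ = []
  consecEdge⇒linked {L = _ ∷ []} _ = [-]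
  consecEdge⇒linked {L = _ ∷ _ ∷ _} f =
    f (inj₁ (inj₁ (refl , refl))) ∷ consecEdge⇒linked (f ∘ inj₂)

record _⊑_ {n : ℕ} (H H′ : Subgraph n) : Set where
  field
    V⊆ : ∀ {x} → V H x → V H′ x
    E⊆ : ∀ {a b} → E H a b → E H′ a b
open _⊑_

module _ {n : ℕ} where

  Ball-mono : ∀ {R R′ : Fin n → Fin n → Set} {S S′ : Fin n → Set} →
    (∀ {a b} → R a b → R′ a b) → (∀ {x} → S x → S′ x) →
    ∀ r {x} → Ball R S r x → Ball R′ S′ r x
  Ball-mono R⊆ S⊆ zero s = S⊆ s
  Ball-mono R⊆ S⊆ (suc r) (inj₁ b) = inj₁ (Ball-mono R⊆ S⊆ r b)
  Ball-mono R⊆ S⊆ (suc r) (inj₂ (y , b , e)) = inj₂ (y , Ball-mono R⊆ S⊆ r b , R⊆ e)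

  Deg≥3-mono : ∀ {H H′ : Subgraph n} {v} → H ⊑ H′ → Deg≥3 H v → Deg≥3 H′ v
  Deg≥3-mono H⊑ (v∈ , x , y , z , distinct , vx , vy , vz) =
    V⊆ H⊑ v∈ , x , y , z , distinct , E⊆ H⊑ vx , E⊆ H⊑ vy , E⊆ H⊑ vz

  Yset-mono : ∀ {H H′ : Subgraph n} {x} → H ⊑ H′ → Yset H x → Yset H′ x
  Yset-mono H⊑ = Ball-mono (E⊆ H⊑) (Deg≥3-mono H⊑) 2

  cycle-edges-in-G : ∀ {G : Graph n} {L a b} → IsCycle G L → CycleEdge L a b → Adj G a b
  cycle-edges-in-G {G} (_ , linked , _) (inj₁ c) = linked⇒consecEdge (sym G) linked c
  cycle-edges-in-G {G} (_ , _ , _ , _ , _ , h , l , adj) (inj₂ (inj₁ (ha , lb)))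
    with ≡just-unique h ha | ≡just-unique l lb
  ... | refl | refl = sym G adj
  cycle-edges-in-G (_ , _ , _ , _ , _ , h , l , adj) (inj₂ (inj₂ (hb , la)))
    with ≡just-unique h hb | ≡just-unique l la
  ... | refl | refl = adj

module _ {n : ℕ} (G : Graph n) (H : Subgraph n) (Z : Fin n → Set)
         (E⇒V : ∀ {a b} → E H a b → V H a) (E-sym : ∀ {a b} → E H a b → E H b a) where

  hPath-to-first-hit : ∀ {v w rest} → Unique (v ∷ rest) →
    (∀ {a b} → ConsecEdge (v ∷ rest) a b → Adj G a b) → Avoids Z (v ∷ rest) →
    V H v → head rest ≡ just w → ¬ E H v w → First (∁ (V H)) (V H) rest →
    ∃ λ L → HPathIn G H Z L
  hPath-to-first-hit {v} {w} u adj avoids vH hw new first with toView first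
  ... | First._++_∷_ {ys} {h} outside hH zs =
    prefix , (AllPairs-++⁻ˡ prefix (subst Unique W≡ u) , consecEdge⇒linked (adj ∘ in-W)) ,
    All.++⁻ˡ prefix (subst (Avoids Z) W≡ avoids) , long , ends , inner-outside , edges-new
    where
    prefix = v ∷ ys ++ [ h ]
    W≡ : v ∷ ys ++ h ∷ zs ≡ prefix ++ zs
    W≡ = cong (v ∷_) (≡-sym (++-assoc ys [ h ] zs))
    in-W : ∀ {a b} → ConsecEdge prefix a b → ConsecEdge (v ∷ ys ++ h ∷ zs) a b
    in-W {a} {b} c = subst (λ L → ConsecEdge L a b) (≡-sym W≡) (consecEdge-++⁺ prefix (inj₁ c))
    long : 2 ≤ length prefix
    long = s≤s (subst (1 ≤_) (≡-sym (length-++ ys)) (ℕ.m≤n+m 1 (length ys)))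
    ends : ∀ x → EndSet prefix x → V H x
    ends x (inj₁ refl) = vH
    ends x (inj₂ l) = subst (V H) (≡just-unique (last-++ (v ∷ ys)) l) hH
    inner-outside : All (∁ (V H)) (inner prefix)
    inner-outside = subst (All (∁ (V H))) (≡-sym (dropLast-∷ʳ ys)) outside
    first-edge-new : ∀ {a b} → Joins (just v) (just w) a b → ¬ E H a b
    first-edge-new (inj₁ (refl , refl)) = new
    first-edge-new (inj₂ (refl , refl)) = new ∘ E-sym
    edges-new : ∀ a b → ConsecEdge prefix a b → ¬ E H a b
    edges-new a b c with consecEdge-∷ c
    ... | inj₁ j = first-edge-new (subst (λ m → Joins (just v) m a b) (≡-trans (head-++ ys) hw) j)
    ... | inj₂ c′ with consecEdge-∷ʳ ys c′
    ...   | inj₁ a∈ = All.lookup outside a∈ ∘ E⇒V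
    ...   | inj₂ b∈ = All.lookup outside b∈ ∘ E⇒V ∘ E-sym

  hPath-from-cycle : ∀ {L v u w} → IsCycle G L → Avoids Z L → u ∈ L →
    V H v → V H u → v ≢ u → CycleEdge L v w → ¬ E H v w → ¬ ¬ ∃ λ P → HPathIn G H Z P
  hPath-from-cycle cyc@(uL , _) avoids u∈L vH uH v≢u vw new
    with rotate-to-edge uL (λ { refl → irrefl G (cycle-edges-in-G {G = G} cyc vw) }) vw
  ... | ws , same with ∈-resp-↭ (perm same) u∈L
  ...   | here u≡v = ⊥-elim (v≢u (≡-sym u≡v))
  ...   | there u∈rest =
    hPath-to-first-hit (SameCycle-unique same uL) (cycle-edges-in-G {G = G} cyc ∘ edges⁻ same ∘ inj₁)
      (All-resp-↭ (perm same) avoids) vH refl new <$> ¬¬-first (lose u∈rest uH)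

module _ {n : ℕ} (D : EarData n) where

  EarEdge : Idx D → Fin n → Fin n → Set
  EarEdge e = earE (earP D e) (toℕ (proj₂ e))

  ear-kind : ∀ (e : Idx D) → toℕ (proj₂ e) ≡ 0 ⊎ ∃ λ k → toℕ (proj₂ e) ≡ suc k
  ear-kind e with toℕ (proj₂ e)
  ... | zero = inj₁ refl
  ... | suc k = inj₂ (k , refl)

  earE⇒CycleEdge : ∀ {L : List (Fin n)} k {a b} → earE L k a b → CycleEdge L a b
  earE⇒CycleEdge zero c = c
  earE⇒CycleEdge (suc _) c = inj₁ c

  earE-sym : ∀ {L : List (Fin n)} k {a b} → earE L k a b → earE L k b a
  earE-sym {L} zero = cycleEdge-sym L
  earE-sym {L} (suc _) = consecEdge-sym L

  EarEdge⇒CycleEdge : ∀ {e : Idx D} {a b} → EarEdge e a b → CycleEdge (earP D e) a b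
  EarEdge⇒CycleEdge {e} = earE⇒CycleEdge (toℕ (proj₂ e))

  EarEdge-∈ : ∀ {e : Idx D} {a b} → EarEdge e a b → a ∈ earP D e
  EarEdge-∈ {e} c = cycleEdge-∈ (earP D e) (EarEdge⇒CycleEdge c)

  cycleEdge⇒EarEdge : ∀ {e : Idx D} {a b} → toℕ (proj₂ e) ≡ 0 →
    CycleEdge (earP D e) a b → EarEdge e a b
  cycleEdge⇒EarEdge {e} {a} {b} j≡0 = subst (λ k → earE (earP D e) k a b) (≡-sym j≡0)

  consecEdge⇒EarEdge : ∀ {e : Idx D} {k a b} → toℕ (proj₂ e) ≡ suc k →
    ConsecEdge (earP D e) a b → EarEdge e a b
  consecEdge⇒EarEdge {e} {a = a} {b} j≡1+k = subst (λ k → earE (earP D e) k a b) (≡-sym j≡1+k)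

  EarEdge⇒ConsecEdge : ∀ {e : Idx D} {k a b} → toℕ (proj₂ e) ≡ suc k →
    EarEdge e a b → ConsecEdge (earP D e) a b
  EarEdge⇒ConsecEdge {e} {a = a} {b} j≡1+k = subst (λ k → earE (earP D e) k a b) j≡1+k

  module _ {S : Idx D → Set} where

    SubOf-E⇒V : ∀ {a b} → E (SubOf D S) a b → V (SubOf D S) a
    SubOf-E⇒V (e , s , c) = e , s , EarEdge-∈ c

    SubOf-E-sym : ∀ {a b} → E (SubOf D S) a b → E (SubOf D S) b a
    SubOf-E-sym (e , s , c) = e , s , earE-sym (toℕ (proj₂ e)) c

    SubOf-mono : ∀ {S′ : Idx D → Set} → (∀ {e} → S e → S′ e) → SubOf D S ⊑ SubOf D S′
    SubOf-mono S⊆ = record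
      { V⊆ = λ (e , s , x∈) → e , S⊆ s , x∈
      ; E⊆ = λ (e , s , c) → e , S⊆ s , c
      }

    Deg≥3-restrict : ∀ {S′ : Idx D → Set} {v} → (∀ {e} → v ∈ earP D e → S e) →
      Deg≥3 (SubOf D S′) v → Deg≥3 (SubOf D S) v
    Deg≥3-restrict only ((e , _ , v∈) , x , y , z , distinct , vx , vy , vz) =
      (e , only v∈ , v∈) , x , y , z , distinct , restrict vx , restrict vy , restrict vz
      where
      restrict : ∀ {w} → E (SubOf D _) _ w → E (SubOf D S) _ w
      restrict (e , _ , c) = e , only (EarEdge-∈ c) , c

  PathEarBetween : Fin n → Fin n → Idx D → Set
  PathEarBetween v₁ v₂ e =
    1 ≤ toℕ (proj₂ e) × (∀ x → (x ≡ v₁ ⊎ x ≡ v₂) ⇔ EndSet (earP D e) x)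

  _≟ᵉ_ : DecidableEquality (Idx D)
  _≟ᵉ_ = Product.≡-dec _≟ᶠ_ _≟ᶠ_

  any-ear? : ∀ {S : Idx D → Set} → (∀ e → Dec (S e)) → Dec (∃ S)
  any-ear? S? = map′ (λ (i , j , s) → (i , j) , s) (λ ((i , j) , s) → i , j , s)
                     (any? λ i → any? λ j → S? (i , j))

  pathEarBetween? : ∀ v₁ v₂ e → Dec (PathEarBetween v₁ v₂ e)
  pathEarBetween? v₁ v₂ e = 1 ℕ.≤? toℕ (proj₂ e) ×-dec all? λ x →
    ((x ≟ᶠ v₁) ⊎-dec (x ≟ᶠ v₂)) ⇔-dec (≡-just? (head L) x ⊎-dec ≡-just? (last L) x)
    where
    L = earP D e
    ≡-just? : ∀ m x → Dec (m ≡ just x)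
    ≡-just? m x = Maybe.≡-dec _≟ᶠ_ m (just x)

module EarDecomposition {n : ℕ} {G : Graph n} {D : EarData n}
                        (ced : IsCoarseEarDecomposition G D) where
  open IsCoarseEarDecomposition ced

  rank : Idx D → ℕ × ℕ
  rank e = toℕ (proj₁ e) , toℕ (proj₂ e)

  -- The order in which ears are added: with the 0-based indices of Defs, H≺ (i , j) below is
  -- Hlt D i = H_{i,ℓ_i} when j is 0, and Hle D i (j - 1) = H_{i+1,j} otherwise.
  _≺_ : Rel (Idx D) 0ℓ
  _≺_ = ×-Lex _≡_ _<_ _<_ on rank

  _≼_ : Rel (Idx D) 0ℓ
  e ≼ f = e ≺ f ⊎ e ≡ f

  ≺-wellFounded : WellFounded _≺_
  ≺-wellFounded = On.wellFounded rank (×-wellFounded <-wellFounded <-wellFounded)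

  private
    module Lex = IsStrictTotalOrder
      (×-isStrictTotalOrder ℕ.<-isStrictTotalOrder ℕ.<-isStrictTotalOrder)

  rank-injective : ∀ {e f} → Pointwise _≡_ _≡_ (rank e) (rank f) → e ≡ f
  rank-injective {i , _} {_ , _} (i≡ , j≡) with toℕ-injective i≡
  ... | refl = cong (i ,_) (toℕ-injective j≡)

  ≼-≺-trans : ∀ {e f g} → e ≼ f → f ≺ g → e ≺ g
  ≼-≺-trans (inj₁ e≺f) f≺g = Lex.trans e≺f f≺g
  ≼-≺-trans (inj₂ refl) f≺g = f≺g

  ≼-trans : ∀ {e f g} → e ≼ f → f ≼ g → e ≼ g
  ≼-trans e≼f (inj₁ f≺g) = inj₁ (≼-≺-trans e≼f f≺g)
  ≼-trans e≼f (inj₂ refl) = e≼f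

  ≼-total : ∀ e f → e ≼ f ⊎ f ≺ e
  ≼-total e f with Lex.compare (rank e) (rank f)
  ... | tri< e≺f _ _ = inj₁ (inj₁ e≺f)
  ... | tri≈ _ same _ = inj₁ (inj₂ (rank-injective same))
  ... | tri> _ _ f≺e = inj₂ f≺e

  upper-bound : ∀ {S : Idx D → Set} {e f} → S e → S f → ∃ λ m → S m × e ≼ m × f ≼ m
  upper-bound {e = e} {f} se sf with ≼-total e f
  ... | inj₁ e≼f = f , sf , e≼f , inj₂ refl
  ... | inj₂ f≺e = e , se , inj₂ refl , inj₁ f≺e

  H≺ H≼ : Idx D → Subgraph n
  H≺ e = SubOf D (_≺ e)
  H≼ e = SubOf D (_≼ e)

  H≺⊑H≼ : ∀ {e} → H≺ e ⊑ H≼ e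
  H≺⊑H≼ = SubOf-mono D inj₁

  deg≥3-by-some-ear : ∀ {S v} → Deg≥3 (SubOf D S) v → ∃ λ m → S m × Deg≥3 (H≼ m) v
  deg≥3-by-some-ear
    ((e₀ , s₀ , v∈) , x , y , z , distinct , (e₁ , s₁ , vx) , (e₂ , s₂ , vy) , (e₃ , s₃ , vz))
    with upper-bound s₀ s₁
  ... | m₁ , t₁ , e₀≼ , e₁≼ with upper-bound t₁ s₂
  ... | m₂ , t₂ , m₁≼ , e₂≼ with upper-bound t₂ s₃
  ... | m , s , m₂≼ , e₃≼ =
    m , s , (e₀ , ≼-trans e₀≼ m₁≼m , v∈) , x , y , z , distinct ,
    (e₁ , ≼-trans e₁≼ m₁≼m , vx) , (e₂ , ≼-trans e₂≼ m₂≼ , vy) , (e₃ , e₃≼ , vz)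
    where m₁≼m = ≼-trans m₁≼ m₂≼

  module _ {i : Fin (t D)} {j : Fin (ℓ D i)} where

    Hlt⊑H≺ : Hlt D i ⊑ H≺ (i , j)
    Hlt⊑H≺ = SubOf-mono D inj₁

    H≺⊑Hlt : toℕ j ≡ 0 → H≺ (i , j) ⊑ Hlt D i
    H≺⊑Hlt j≡0 = SubOf-mono D λ where
      (inj₁ i′<i) → i′<i
      (inj₂ (_ , j′<j)) → ⊥-elim (ℕ.n≮0 (subst (_ <_) j≡0 j′<j))

    Hle⊑H≺ : ∀ {k} → toℕ j ≡ suc k → Hle D i k ⊑ H≺ (i , j)
    Hle⊑H≺ j≡1+k = SubOf-mono D λ where
      (inj₁ i′<i) → inj₁ i′<i
      (inj₂ (refl , j′≤k)) → inj₂ (refl , subst (_ <_) (≡-sym j≡1+k) (s≤s j′≤k))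

    H≺⊑Hle : ∀ {k} → toℕ j ≡ suc k → H≺ (i , j) ⊑ Hle D i k
    H≺⊑Hle j≡1+k = SubOf-mono D λ where
      (inj₁ i′<i) → inj₁ i′<i
      (inj₂ (i′≡i , j′<j)) →
        inj₂ (toℕ-injective i′≡i , ℕ.≤-pred (subst (_ <_) j≡1+k j′<j))

  cycle-ear : ∀ {i j} → toℕ j ≡ 0 → ¬ ¬ CycleIn G (Zset G (Hlt D i)) (P D i j)
  cycle-ear {i} {j} j≡0 = do
    yes meets-once ← ¬¬-excluded-middle
      where no ¬meets-once → pure (proj₁ (proj₂ (condB i j j≡0) ¬meets-once))
    pure (proj₁ (proj₁ (condB i j j≡0) meets-once))

  path-ear : ∀ {i j k} → toℕ j ≡ suc k → HPathIn G (Hle D i k) (Zset G (Hle D i k)) (P D i j)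
  path-ear {i} {j} {k} j≡1+k = proj₁ (condC i j k j≡1+k)

  ear-unique : ∀ e → ¬ ¬ Unique (earP D e)
  ear-unique e@(_ , _) with ear-kind D e
  ... | inj₁ j≡0 = (λ ((unique , _) , _) → unique) <$> cycle-ear j≡0
  ... | inj₂ (_ , j≡1+k) = pure (proj₁ (proj₁ (path-ear j≡1+k)))

  ear-edge-irrefl : ∀ {S : Idx D → Set} {a b} → E (SubOf D S) a b → a ≢ b
  ear-edge-irrefl (e@(_ , _) , _ , c) refl with ear-kind D e
  ... | inj₁ j≡0 = cycle-ear j≡0 λ (cycle , _) →
    irrefl G (cycle-edges-in-G {G = G} cycle (EarEdge⇒CycleEdge D c))
  ... | inj₂ (_ , j≡1+k) with path-ear j≡1+k
  ...   | (_ , linked) , _ = irrefl G (linked⇒consecEdge (sym G) linked (EarEdge⇒ConsecEdge D j≡1+k c))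

  ear-avoids-Y : ∀ {e x} → x ∈ earP D e → ¬ Yset (H≺ e) x
  ear-avoids-Y {e@(_ , _)} x∈ y with ear-kind D e
  ... | inj₁ j≡0 = cycle-ear j≡0 λ (_ , avoids) →
    All.lookup avoids x∈ (inj₁ (Yset-mono (H≺⊑Hlt j≡0) y))
  ... | inj₂ (_ , j≡1+k) with path-ear j≡1+k
  ...   | _ , avoids , _ = All.lookup avoids x∈ (inj₁ (Yset-mono (H≺⊑Hle j≡1+k) y))

  Y-confines-ears : ∀ {Q x e} → Yset (H≼ Q) x → x ∈ earP D e → e ≼ Q
  Y-confines-ears {Q} {e = e} y x∈ with ≼-total e Q
  ... | inj₁ e≼Q = e≼Q
  ... | inj₂ Q≺e =
    ⊥-elim (ear-avoids-Y x∈ (Yset-mono (SubOf-mono D (λ f≼Q → ≼-≺-trans f≼Q Q≺e)) y))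

  first-ear-neighbours : ∀ {m v} → v ∈ earP D m → (∀ {f} → f ≺ m → v ∉ earP D f) →
    ¬ ¬ TwoNeighbours (EarEdge D m) v
  first-ear-neighbours {m@(_ , _)} v∈ first with ear-kind D m
  ... | inj₁ j≡0 = do
    ((unique , _ , long , _) , _) ← cycle-ear j≡0
    pure (TwoNeighbours-map (cycleEdge⇒EarEdge D j≡0) (cycle-two-neighbours unique long v∈))
  ... | inj₂ (_ , j≡1+k) with path-ear j≡1+k | ∈⇒end⊎inner v∈
  ...   | (unique , _) , _ | inj₂ inner =
    pure (TwoNeighbours-map (consecEdge⇒EarEdge D j≡1+k) (inner-two-neighbours unique inner))
  ...   | _ , _ , _ , ends , _ | inj₁ end with V⊆ (Hle⊑H≺ j≡1+k) (ends _ end)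
  ...     | f , f≺m , v∈f = ⊥-elim (first f≺m v∈f)

  two-neighbours-before : ∀ {e v} → V (H≺ e) v → ¬ ¬ TwoNeighbours (E (H≺ e)) v
  two-neighbours-before {e} {v} (f , f≺e , v∈f) = do
    (m , v∈m , first) ← ¬¬-minimal {P = λ m → v ∈ earP D m} ≺-wellFounded v∈f
    let m≺e = case ≼-total m f of λ where
          (inj₁ m≼f) → ≼-≺-trans m≼f f≺e
          (inj₂ f≺m) → ⊥-elim (first f≺m v∈f)
    TwoNeighbours-map (λ c → m , m≺e , c) <$> first-ear-neighbours v∈m first

  path-ear-end-branches : ∀ {e k v} → toℕ (proj₂ e) ≡ suc k → EndSet (earP D e) v →
    ¬ ¬ Deg≥3 (H≼ e) v
  path-ear-end-branches {e@(_ , _)} {v = v} j≡1+k end with path-ear j≡1+k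
  ... | _ , _ , long , ends , _ , edges-new with end-neighbour long end
  ...   | c , vc = do
    two-neighbours {a} {b} a≢b va vb ← two-neighbours-before (V⊆ (Hle⊑H≺ j≡1+k) (ends v end))
    pure ((_ , inj₂ refl , end-∈ end) , a , b , c , (a≢b , old≢c va , old≢c vb) ,
          E⊆ H≺⊑H≼ va , E⊆ H≺⊑H≼ vb , (_ , inj₂ refl , consecEdge⇒EarEdge D j≡1+k vc))
    where
    old≢c : ∀ {x} → E (H≺ e) v x → x ≢ c
    old≢c vx refl = edges-new v c vc (E⊆ (H≺⊑Hle j≡1+k) vx)

  BranchesAt : Idx D → Fin n → Set
  BranchesAt Q v = Deg≥3 (H≼ Q) v × ¬ Deg≥3 (H≺ Q) v

  branch-spreads : ∀ {Q u w} → Deg≥3 (H≼ Q) u → E (Hall D) u w → Deg≥3 (Hall D) w →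
    Deg≥3 (H≼ Q) w
  branch-spreads du (e , _ , uw) dw =
    Deg≥3-restrict D (Y-confines-ears (inj₁ (inj₂ (_ , du , uw-early)))) dw
    where
    uw-early = e , Y-confines-ears (inj₁ (inj₁ du)) (EarEdge-∈ D uw) , uw

  branch-pair : ∀ {Q v₁ v₂} → E (Hall D) v₁ v₂ → Deg≥3 (Hall D) v₁ → Deg≥3 (Hall D) v₂ →
    Deg≥3 (H≼ Q) v₁ ⊎ Deg≥3 (H≼ Q) v₂ → Deg≥3 (H≼ Q) v₁ × Deg≥3 (H≼ Q) v₂
  branch-pair edge d₁ d₂ (inj₁ d) = d , branch-spreads d edge d₂
  branch-pair edge d₁ d₂ (inj₂ d) = branch-spreads d (SubOf-E-sym D edge) d₁ , d

  not-before-minimal : ∀ {Q v} → (∀ {m} → m ≺ Q → ¬ Deg≥3 (H≼ m) v) → ¬ Deg≥3 (H≺ Q) v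
  not-before-minimal none d with deg≥3-by-some-ear d
  ... | m , m≺Q , dm = none m≺Q dm

  critical-ear : ∀ {v₁ v₂} → E (Hall D) v₁ v₂ → Deg≥3 (Hall D) v₁ → Deg≥3 (Hall D) v₂ →
    ¬ ¬ ∃ λ Q → BranchesAt Q v₁ × BranchesAt Q v₂
  critical-ear {v₁} {v₂} edge d₁ d₂ = do
    let (_ , _ , d₁-early) = deg≥3-by-some-ear d₁
    (Q , branches , minimal) ←
      ¬¬-minimal {P = λ Q → Deg≥3 (H≼ Q) v₁ ⊎ Deg≥3 (H≼ Q) v₂} ≺-wellFounded (inj₁ d₁-early)
    let (deg₁ , deg₂) = branch-pair edge d₁ d₂ branches
    pure (Q , (deg₁ , not-before-minimal (λ m≺Q → minimal m≺Q ∘ inj₁)) ,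
              (deg₂ , not-before-minimal (λ m≺Q → minimal m≺Q ∘ inj₂)))

  branch-∈ : ∀ {Q v} → BranchesAt Q v → ¬ ¬ v ∈ earP D Q
  branch-∈ {Q} {v} (deg , fresh) v∉ = fresh (Deg≥3-restrict D only-before deg)
    where
    only-before : ∀ {e} → v ∈ earP D e → e ≺ Q
    only-before v∈ with Y-confines-ears (inj₁ (inj₁ deg)) v∈
    ... | inj₁ e≺Q = e≺Q
    ... | inj₂ refl = ⊥-elim (v∉ v∈)

  branch-old : ∀ {Q v} → BranchesAt Q v → ¬ ¬ V (H≺ Q) v
  branch-old {Q} {v} ((_ , _ , _ , _ , distinct , vx , vy , vz) , _) new =
    ear-unique Q λ unique → cycle-≤2-neighbours unique (on-Q vx) (on-Q vy) (on-Q vz) distinct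
    where
    on-Q : ∀ {w} → E (H≼ Q) v w → CycleEdge (earP D Q) v w
    on-Q (e , inj₁ e≺Q , c) = ⊥-elim (new (e , e≺Q , EarEdge-∈ D c))
    on-Q (_ , inj₂ refl , c) = EarEdge⇒CycleEdge D c

  branch-new-edge : ∀ {Q v} → BranchesAt Q v →
    ¬ ¬ ∃ λ w → CycleEdge (earP D Q) v w × ¬ E (H≺ Q) v w
  branch-new-edge {Q} {v} ((_ , x , y , z , distinct , vx , vy , vz) , fresh) none =
    old vx λ vx′ → old vy λ vy′ → old vz λ vz′ →
    fresh (SubOf-E⇒V D vx′ , x , y , z , distinct , vx′ , vy′ , vz′)
    where
    old : ∀ {w} → E (H≼ Q) v w → ¬ ¬ E (H≺ Q) v w
    old (e , inj₁ e≺Q , c) = pure (e , e≺Q , c)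
    old (_ , inj₂ refl , c) new = none (_ , EarEdge⇒CycleEdge D c , new)

  critical-ear-is-path-ear : ∀ {Q v₁ v₂} → BranchesAt Q v₁ → BranchesAt Q v₂ → v₁ ≢ v₂ →
    ¬ ¬ ∃ λ k → toℕ (proj₂ Q) ≡ suc k
  critical-ear-is-path-ear {Q@(i , _)} b₁ b₂ v₁≢v₂ with ear-kind D Q
  ... | inj₂ path = pure path
  ... | inj₁ j≡0 = do
    (cycle , avoids) ← cycle-ear j≡0
    v₁-old ← branch-old b₁
    v₂-old ← branch-old b₂
    v₂∈ ← branch-∈ b₂
    (w , v₁w , new) ← branch-new-edge b₁
    (_ , hPath) ← hPath-from-cycle G (Hlt D i) _ (SubOf-E⇒V D) (SubOf-E-sym D) cycle avoids v₂∈
      (V⊆ (H≺⊑Hlt j≡0) v₁-old) (V⊆ (H≺⊑Hlt j≡0) v₂-old) v₁≢v₂ v₁w (new ∘ E⊆ Hlt⊑H≺)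
    ⊥-elim (condA i _ hPath)

  branch-is-end : ∀ {Q k v} → BranchesAt Q v → toℕ (proj₂ Q) ≡ suc k →
    ¬ ¬ EndSet (earP D Q) v
  branch-is-end {_ , _} b j≡1+k with path-ear j≡1+k
  ... | _ , _ , _ , _ , inner-new , _ = do
    v∈ ← branch-∈ b
    inj₁ end ← pure (∈⇒end⊎inner v∈)
      where inj₂ inner →
              ⊥-elim (branch-old b (All.lookup inner-new inner ∘ V⊆ (H≺⊑Hle j≡1+k)))
    pure end

  critical-path-ear : ∀ {Q k v₁ v₂} → BranchesAt Q v₁ → BranchesAt Q v₂ → v₁ ≢ v₂ →
    toℕ (proj₂ Q) ≡ suc k → ¬ ¬ PathEarBetween D v₁ v₂ Q
  critical-path-ear b₁ b₂ v₁≢v₂ j≡1+k = do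
    end₁ ← branch-is-end b₁ j≡1+k
    end₂ ← branch-is-end b₂ j≡1+k
    pure (subst (1 ≤_) (≡-sym j≡1+k) (s≤s z≤n) ,
          λ x → mk⇔ Sum.[ (λ { refl → end₁ }) , (λ { refl → end₂ }) ]
                    (ends-determined end₁ end₂ v₁≢v₂))

  path-ear-between-is-critical : ∀ {Q e v₁ v₂} → BranchesAt Q v₁ → PathEarBetween D v₁ v₂ e →
    ¬ ¬ e ≡ Q
  path-ear-between-is-critical {e = e@(_ , _)} {v₁} (deg , fresh) (1≤j , ends) with ear-kind D e
  ... | inj₁ j≡0 = ⊥-elim (ℕ.<-irrefl (≡-sym j≡0) 1≤j)
  ... | inj₂ (_ , j≡1+k) = case Y-confines-ears (inj₁ (inj₁ deg)) (end-∈ end₁) of λ where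
      (inj₂ e≡Q) → pure e≡Q
      (inj₁ e≺Q) _ → path-ear-end-branches j≡1+k end₁
                       (fresh ∘ Deg≥3-mono (SubOf-mono D (λ f≼e → ≼-≺-trans f≼e e≺Q)))
    where end₁ = Equivalence.to (ends v₁) (inj₁ refl)

  unique-path-ear-between : ∀ {v₁ v₂} →
    E (Hall D) v₁ v₂ → Deg≥3 (Hall D) v₁ → Deg≥3 (Hall D) v₂ → ¬ ¬ ∃! _≡_ (PathEarBetween D v₁ v₂)
  unique-path-ear-between edge d₁ d₂ = do
    (Q , b₁ , b₂) ← critical-ear edge d₁ d₂
    let v₁≢v₂ = ear-edge-irrefl edge
    (_ , j≡1+k) ← critical-ear-is-path-ear b₁ b₂ v₁≢v₂
    between ← critical-path-ear b₁ b₂ v₁≢v₂ j≡1+k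
    pure (Q , between , λ {e} between′ →
      decidable-stable (_≟ᵉ_ D Q e) (≡-sym <$> path-ear-between-is-critical b₁ between′))

corollary3p3 : ∀ {n} (G : Graph n) (D : EarData n) → IsCoarseEarDecomposition G D →
    ∀ (v₁ v₂ : Fin n) → E (Hall D) v₁ v₂ → Deg≥3 (Hall D) v₁ → Deg≥3 (Hall D) v₂ →
    ∃! _≡_ (λ (e : Idx D) → 1 ≤ toℕ (proj₂ e) ×
      (∀ x → (x ≡ v₁ ⊎ x ≡ v₂) ⇔ EndSet (earP D e) x))
corollary3p3 G D ced v₁ v₂ edge d₁ d₂ =
  ∃!-stable (any-ear? D (pathEarBetween? D v₁ v₂)) (_≟ᵉ_ D) (unique-path-ear-between edge d₁ d₂)
  where open EarDecomposition ced
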